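{- Let $p$ be a prime, let $k>0$ be an integer, and let $G = C_{p^k}(S)$ be a circulant graph on $n=p^k$ vertices with $\emptyset \neq S \subseteq \{1,\ldots,\lfloor n/2\rfloor\}$ (i.e. $G$ has at least one edge). Then the reduced Euler characteristic of the independence complex of $G$ is nonzero: $\widetilde{\chi}(\Delta(G)) \neq 0$.
   Context: For $S \subseteq \{1,\ldots,\lfloor n/2\rfloor\}$, the circulant graph $C_n(S)$ is the simple graph with vertex set $\mathbb{Z}_n=\{0,\ldots,n-1\}$ and edge set $\{\{i,j\} : |j-i|_n \in S\}$, where $|k|_n=\min\{|k|, n-|k|\}$. The independence complex $\Delta(G)$ is the simplicial complex whose faces are the independent sets of $G$ (sets of pairwise non-adjacent vertices). If $f_{i-1}$ denotes the number of independent sets of cardinality $i$ (so $f_{ -1}=1$, corresponding to the empty set) and $d$ is the maximum cardinality of an independent set, the reduced Euler characteristic is $\widetilde{\chi}(\Delta(G))=\sum_{i=0}^{d}(-1)^{i-1}f_{i-1}$. -}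

module Defs where

open import Data.Nat using (ℕ; zero; suc; _+_; _∸_; _≤_; _<_; _⊓_; _^_)
open import Data.Nat.DivMod using (_/_)
open import Data.Bool using (Bool; true; false; if_then_else_)
open import Data.Fin using (Fin; toℕ)
open import Data.Fin.Subset using (Subset; _∈_; ∣_∣)
open import Data.Vec using (Vec; []; _∷_)
open import Data.List using (List; []; _∷_; map; _++_; filter; sum)
open import Data.List.Membership.Propositional as L using ()
open import Data.Integer using (ℤ; -1ℤ; 1ℤ) renaming (_+_ to _+ℤ_)
open import Relation.Nullary using (¬_)
open import Relation.Unary using (Decidable)
open import Data.Product using (_×_)
open import Data.Fin.Properties using (all?)
open import Data.Fin.Subset.Properties using (_∈?_)
open import Data.Nat.Properties using (_≟_)
open import Data.List.Membership.DecPropositional _≟_ using () renaming (_∈?_ to _∈ℕ?_)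
open import Relation.Nullary using (Dec; yes; no; ¬?)
open import Relation.Nullary.Decidable using (_→-dec_)

circDist : (n i j : ℕ) → ℕ
circDist n i j = d ⊓ (n ∸ d)
  where
  d = (i ∸ j) + (j ∸ i)

-- The connection set S is given as a list of natural numbers (as a set:
-- only membership matters).  Adjacency in the circulant graph C_n(S):
-- i ~ j  iff  |j - i|_n ∈ S.
Adjacent : (n : ℕ) (S : List ℕ) → Fin n → Fin n → Set
Adjacent n S i j = circDist n (toℕ i) (toℕ j) L.∈ S

Independent : (n : ℕ) (S : List ℕ) → Subset n → Set
Independent n S I = ∀ i j → i ∈ I → j ∈ I → ¬ Adjacent n S i j

allSubsets : (n : ℕ) → List (Subset n)
allSubsets zero = [] ∷ []
allSubsets (suc n) = map (false ∷_) (allSubsets n) ++ map (true ∷_) (allSubsets n)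

-- (-1)^(m-1)
signPred : ℕ → ℤ
signPred zero = -1ℤ
signPred (suc zero) = 1ℤ
signPred (suc (suc m)) = signPred m

sumℤ : List ℤ → ℤ
sumℤ [] = Data.Integer.0ℤ
  where import Data.Integer
sumℤ (x ∷ xs) = x +ℤ sumℤ xs

-- Reduced Euler characteristic of the independence complex of C_n(S):
--   χ̃ = Σ_{I independent} (-1)^{|I|-1}  = Σ_i (-1)^{i-1} f_{i-1}
-- (the empty set contributes -1).
independent? : (n : ℕ) (S : List ℕ) → Decidable (Independent n S)
independent? n S I = all? λ i → all? λ j →
  (i ∈? I) →-dec ((j ∈? I) →-dec ¬? (circDist n (toℕ i) (toℕ j) ∈ℕ? S))

reducedEuler : (n : ℕ) (S : List ℕ) → ℤ
reducedEuler n S = sumℤ (map (λ I → signPred ∣ I ∣) (filter (independent? n S) (allSubsets n)))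

module Submission where

-- The rotation i ↦ i + 1 of ℤ_n is an automorphism of C_n(S), so it permutes the
-- independent sets and preserves their size: the terms (-1)^(|I|-1) of χ̃ are constant on
-- rotation orbits.  Counting each orbit through its lexicographically least member, an orbit
-- contributes its length times the common term, and that length is the least period of I,
-- a divisor of n = p^k, hence divisible by p unless I is fixed by the rotation.  The only
-- fixed subsets are ∅, contributing -1, and the whole vertex set, which is not independent
-- because S ≠ ∅.  Therefore χ̃ ≡ -1 (mod p).

open import Defs
open import Data.Nat using (ℕ; _^_; _/_; _≤_; _<_)
open import Data.Nat.Primality using (Prime)
open import Data.List using (List; [])
open import Data.List.Relation.Unary.All using (All)
open import Data.Product using (_×_)
open import Data.Integer using (ℤ; 0ℤ)
open import Relation.Binary.PropositionalEquality using (_≡_; _≢_)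

open import Data.Nat as ℕ using (zero; suc; z≤n; s≤s; _∸_; _⊓_; _%_; _<?_; NonZero)
import Data.Nat.Properties as ℕₚ
open import Data.Nat.DivMod using (m≡m%n+[m/n]*n; m%n<n; m/n*n≤m)
open import Data.Nat.Divisibility using (_∣_; m%n≡0⇒n∣m; ∣⇒≤; ∣1⇒≡1)
open import Data.Nat.GCD using (gcd[m,n]∣m; gcd[m,n]∣n)
open import Data.Nat.Coprimality using (gcd≡1⇒coprime; coprime-divisor)
open import Data.Nat.Primality using (prime⇒irreducible; prime⇒nonZero; ¬prime[1])
open import Data.Integer using (+_; 1ℤ; -1ℤ; _+_; _*_)
import Data.Integer.Properties as ℤₚ
open import Data.Integer.Divisibility.Signed as ℤ∣ using () renaming (_∣_ to _∣ℤ_)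
open import Algebra.Properties.CommutativeSemigroup ℤₚ.+-commutativeSemigroup using (interchange)
open import Data.Bool using (Bool; true; false; if_then_else_)
import Data.Bool as Bool
import Data.Fin as Fin
open import Data.Fin using (Fin; toℕ; fromℕ<)
open import Data.Fin.Properties using (toℕ<n; toℕ-fromℕ<)
open import Data.Fin.Subset using (Subset; _∈_; ∣_∣; ⊥; ⊤)
open import Data.Fin.Subset.Properties using (∉⊥; ∈⊤; ∣⊥∣≡0; ∣⊤∣≡n)
open import Data.Vec using (Vec; []; _∷_; _∷ʳ_; replicate; toList; here; there)
import Data.Vec.Properties as Vecₚ
open import Data.List using (_∷_; _++_; map; filter; length)
import Data.List.Properties as Listₚ
open import Data.List.Membership.Propositional using () renaming (_∈_ to _∈ₗ_)
open import Data.List.Relation.Unary.All using (_∷_)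
open import Data.List.Relation.Unary.Any using (here)
open import Data.Product using (∃-syntax; _,_; proj₁; proj₂)
import Data.Sum as Sum
open import Data.Sum using (_⊎_; inj₁; inj₂)
open import Data.Empty using (⊥-elim)
open import Function using (_∘_; _⇔_; Equivalence; mk⇔)
open import Relation.Nullary using (¬_; Dec; yes; no; does)
open import Relation.Nullary.Decidable using (dec-true; dec-false; does-⇔)
open import Relation.Unary using (Decidable)
open import Relation.Binary.PropositionalEquality using (refl; sym; trans; cong; cong₂; subst; subst₂; module ≡-Reasoning)
open import Relation.Binary.Definitions using (tri<; tri≈; tri>)

private
  variable
    A : Set
    m n : ℕ

-- Sums over all subsets

sumSubsets : ∀ n → (Subset n → ℤ) → ℤ
sumSubsets zero    f = f []
sumSubsets (suc n) f = sumSubsets n (f ∘ (false ∷_)) + sumSubsets n (f ∘ (true ∷_))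

sumSubsets-cong : ∀ n {f g : Subset n → ℤ} → (∀ x → f x ≡ g x) → sumSubsets n f ≡ sumSubsets n g
sumSubsets-cong zero    f≗g = f≗g []
sumSubsets-cong (suc n) f≗g =
  cong₂ _+_ (sumSubsets-cong n (f≗g ∘ (false ∷_))) (sumSubsets-cong n (f≗g ∘ (true ∷_)))

sumSubsets-0 : ∀ n → sumSubsets n (λ _ → 0ℤ) ≡ 0ℤ
sumSubsets-0 zero    = refl
sumSubsets-0 (suc n) = cong₂ _+_ (sumSubsets-0 n) (sumSubsets-0 n)

sumSubsets-+ : ∀ n (f g : Subset n → ℤ) →
               sumSubsets n (λ x → f x + g x) ≡ sumSubsets n f + sumSubsets n g
sumSubsets-+ zero    f g = refl
sumSubsets-+ (suc n) f g =
  trans (cong₂ _+_ (sumSubsets-+ n _ _) (sumSubsets-+ n _ _))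
        (interchange (Σ (f ∘ (false ∷_))) (Σ (g ∘ (false ∷_))) (Σ (f ∘ (true ∷_))) (Σ (g ∘ (true ∷_))))
  where Σ = sumSubsets n

sumSubsets-∣ : ∀ n {k} {f : Subset n → ℤ} → (∀ x → k ∣ℤ f x) → k ∣ℤ sumSubsets n f
sumSubsets-∣ zero    k∣f = k∣f []
sumSubsets-∣ (suc n) k∣f =
  ℤ∣.∣m∣n⇒∣m+n (sumSubsets-∣ n (k∣f ∘ (false ∷_))) (sumSubsets-∣ n (k∣f ∘ (true ∷_)))

sumSubsets-∷ʳ : ∀ n (f : Subset (suc n) → ℤ) →
  sumSubsets (suc n) f ≡ sumSubsets n (λ x → f (x ∷ʳ false)) + sumSubsets n (λ x → f (x ∷ʳ true))
sumSubsets-∷ʳ zero    f = refl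
sumSubsets-∷ʳ (suc n) f =
  trans (cong₂ _+_ (sumSubsets-∷ʳ n (f ∘ (false ∷_))) (sumSubsets-∷ʳ n (f ∘ (true ∷_))))
        (interchange (Σ (λ x → f (false ∷ (x ∷ʳ false)))) (Σ (λ x → f (false ∷ (x ∷ʳ true))))
                     (Σ (λ x → f (true ∷ (x ∷ʳ false)))) (Σ (λ x → f (true ∷ (x ∷ʳ true)))))
  where Σ = sumSubsets n

sumSubsets-empty : ∀ n c → sumSubsets n (λ x → if does (∣ x ∣ ℕ.≟ 0) then c else 0ℤ) ≡ c
sumSubsets-empty zero    c = refl
sumSubsets-empty (suc n) c =
  trans (cong₂ _+_ (sumSubsets-empty n c) (sumSubsets-0 n)) (ℤₚ.+-identityʳ c)

sumBelow : ℕ → (ℕ → ℤ) → ℤ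
sumBelow zero    F = 0ℤ
sumBelow (suc d) F = sumBelow d F + F d

sumBelow-cong : ∀ d {F G : ℕ → ℤ} → (∀ i → i < d → F i ≡ G i) → sumBelow d F ≡ sumBelow d G
sumBelow-cong zero    F≗G = refl
sumBelow-cong (suc d) F≗G =
  cong₂ _+_ (sumBelow-cong d (λ i i<d → F≗G i (ℕₚ.m≤n⇒m≤1+n i<d))) (F≗G d ℕₚ.≤-refl)

sumBelow-const : ∀ d c → sumBelow d (λ _ → c) ≡ + d * c
sumBelow-const zero    c = refl
sumBelow-const (suc d) c = begin
  sumBelow d (λ _ → c) + c ≡⟨ cong (_+ c) (sumBelow-const d c) ⟩
  + d * c + c              ≡⟨ cong (_+_ (+ d * c)) (sym (ℤₚ.*-identityˡ c)) ⟩
  + d * c + 1ℤ * c         ≡⟨ sym (ℤₚ.*-distribʳ-+ c (+ d) 1ℤ) ⟩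
  + (d ℕ.+ 1) * c          ≡⟨ cong (λ t → + t * c) (ℕₚ.+-comm d 1) ⟩
  + suc d * c              ∎
  where open ≡-Reasoning

sumBelow-unique : ∀ d {r} (F : ℕ → ℤ) → r < d → (∀ i → i < d → i ≢ r → F i ≡ 0ℤ) →
                  sumBelow d F ≡ F r
sumBelow-unique zero    F () _
sumBelow-unique (suc d) {r} F r<1+d F≡0 with ℕₚ.m≤n⇒m<n∨m≡n r<1+d
... | inj₁ (s≤s r<d) = begin
  sumBelow d F + F d ≡⟨ cong₂ _+_ (sumBelow-unique d F r<d below) (F≡0 d ℕₚ.≤-refl d≢r) ⟩
  F r + 0ℤ           ≡⟨ ℤₚ.+-identityʳ (F r) ⟩
  F r                ∎
  where
  open ≡-Reasoning
  below = λ i i<d → F≡0 i (ℕₚ.m≤n⇒m≤1+n i<d)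
  d≢r = λ d≡r → ℕₚ.<-irrefl (sym d≡r) r<d
... | inj₂ refl = begin
  sumBelow d F + F d          ≡⟨ cong (_+ F d) (sumBelow-cong d (λ i i<d → F≡0 i (ℕₚ.m≤n⇒m≤1+n i<d) (ℕₚ.<⇒≢ i<d))) ⟩
  sumBelow d (λ _ → 0ℤ) + F d ≡⟨ cong (_+ F d) (trans (sumBelow-const d 0ℤ) (ℤₚ.*-zeroʳ (+ d))) ⟩
  0ℤ + F d                    ≡⟨ ℤₚ.+-identityˡ (F d) ⟩
  F d                         ∎
  where open ≡-Reasoning

sumBelow-* : ∀ d c (F : ℕ → ℤ) → sumBelow d (λ i → c * F i) ≡ c * sumBelow d F
sumBelow-* zero    c F = sym (ℤₚ.*-zeroʳ c)
sumBelow-* (suc d) c F = trans (cong (_+ c * F d) (sumBelow-* d c F)) (sym (ℤₚ.*-distribˡ-+ c _ _))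

sumBelow-restrict : ∀ K d (F : ℕ → ℤ) → d ≤ K →
  sumBelow K (λ i → if does (i <? d) then F i else 0ℤ) ≡ sumBelow d F
sumBelow-restrict zero    zero    F z≤n = refl
sumBelow-restrict (suc K) d       F d≤1+K with ℕₚ.m≤n⇒m<n∨m≡n d≤1+K
... | inj₁ (s≤s d≤K) = begin
  sumBelow K _ + (if does (K <? d) then F K else 0ℤ)
    ≡⟨ cong₂ _+_ (sumBelow-restrict K d F d≤K) (cong (if_then F K else 0ℤ) (dec-false (K <? d) (ℕₚ.≤⇒≯ d≤K))) ⟩
  sumBelow d F + 0ℤ ≡⟨ ℤₚ.+-identityʳ _ ⟩
  sumBelow d F      ∎
  where open ≡-Reasoning
... | inj₂ refl = cong₂ _+_
  (sumBelow-cong K (λ i i<K → cong (if_then F i else 0ℤ) (dec-true (i <? suc K) (ℕₚ.m≤n⇒m≤1+n i<K))))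
  (cong (if_then F K else 0ℤ) (dec-true (K <? suc K) ℕₚ.≤-refl))

sumSubsets-sumBelow : ∀ n K (F : Subset n → ℕ → ℤ) →
  sumSubsets n (λ x → sumBelow K (F x)) ≡ sumBelow K (λ i → sumSubsets n (λ x → F x i))
sumSubsets-sumBelow n zero    F = sumSubsets-0 n
sumSubsets-sumBelow n (suc K) F =
  trans (sumSubsets-+ n (λ x → sumBelow K (F x)) (λ x → F x K))
        (cong (_+ sumSubsets n (λ x → F x K)) (sumSubsets-sumBelow n K F))

-- Cyclic rotation

rotate : Vec A n → Vec A n
rotate []       = []
rotate (x ∷ xs) = xs ∷ʳ x

rotate^ : ℕ → Vec A n → Vec A n
rotate^ zero    x = x
rotate^ (suc i) x = rotate^ i (rotate x)

rotate^-rotate : ∀ i (x : Vec A n) → rotate^ i (rotate x) ≡ rotate (rotate^ i x)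
rotate^-rotate zero    x = refl
rotate^-rotate (suc i) x = rotate^-rotate i (rotate x)

rotate^-+ : ∀ i j (x : Vec A n) → rotate^ (i ℕ.+ j) x ≡ rotate^ i (rotate^ j x)
rotate^-+ zero    j x = refl
rotate^-+ (suc i) j x = trans (rotate^-+ i j (rotate x)) (cong (rotate^ i) (rotate^-rotate j x))

toList-rotate^ : ∀ (x : Vec A n) u w → toList x ≡ u ++ w → toList (rotate^ (length u) x) ≡ w ++ u
toList-rotate^ x       []      w x≡w = trans x≡w (sym (Listₚ.++-identityʳ w))
toList-rotate^ []      (a ∷ u) w ()
toList-rotate^ (y ∷ x) (a ∷ u) w eq with Listₚ.∷-injective eq
... | refl , x≡u++w = begin
  toList (rotate^ (length u) (x ∷ʳ a)) ≡⟨ toList-rotate^ (x ∷ʳ a) u (w ++ a ∷ []) toList[x∷ʳa] ⟩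
  (w ++ a ∷ []) ++ u                    ≡⟨ Listₚ.++-assoc w (a ∷ []) u ⟩
  w ++ a ∷ u                            ∎
  where
  open ≡-Reasoning
  toList[x∷ʳa] : toList (x ∷ʳ a) ≡ u ++ (w ++ a ∷ [])
  toList[x∷ʳa] = trans (Vecₚ.toList-∷ʳ a x)
                       (trans (cong (_++ a ∷ []) x≡u++w) (Listₚ.++-assoc u w (a ∷ [])))

rotate^-length : ∀ n (x : Vec A n) → rotate^ n x ≡ x
rotate^-length n x =
  trans (sym (Vecₚ.cast-is-id refl (rotate^ n x))) (Vecₚ.toList-injective refl (rotate^ n x) x same-list)
  where
  open ≡-Reasoning
  same-list : toList (rotate^ n x) ≡ toList x
  same-list = begin
    toList (rotate^ n x)                   ≡⟨ cong (λ k → toList (rotate^ k x)) (sym (Vecₚ.length-toList x)) ⟩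
    toList (rotate^ (length (toList x)) x) ≡⟨ toList-rotate^ x (toList x) [] (sym (Listₚ.++-identityʳ _)) ⟩
    toList x                               ∎

rotate-injective : ∀ {x y : Vec A n} → rotate x ≡ rotate y → x ≡ y
rotate-injective {n = zero}  {[]} {[]} _ = refl
rotate-injective {n = suc m} {x}  {y}  e =
  trans (sym (rotate^-length (suc m) x)) (trans (cong (rotate^ m) e) (rotate^-length (suc m) y))

rotate^-* : ∀ d (x : Vec A n) → rotate^ d x ≡ x → ∀ q → rotate^ (q ℕ.* d) x ≡ x
rotate^-* d x e zero    = refl
rotate^-* d x e (suc q) = trans (rotate^-+ d (q ℕ.* d) x) (trans (cong (rotate^ d) (rotate^-* d x e q)) e)

rotate^-% : ∀ d .{{_ : NonZero d}} (x : Vec A n) → rotate^ d x ≡ x → ∀ j → rotate^ (j % d) x ≡ rotate^ j x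
rotate^-% d x e j = begin
  rotate^ (j % d) x                         ≡⟨ cong (rotate^ (j % d)) (sym (rotate^-* d x e (j / d))) ⟩
  rotate^ (j % d) (rotate^ (j / d ℕ.* d) x) ≡⟨ sym (rotate^-+ (j % d) (j / d ℕ.* d) x) ⟩
  rotate^ (j % d ℕ.+ j / d ℕ.* d) x         ≡⟨ cong (λ t → rotate^ t x) (sym (m≡m%n+[m/n]*n j d)) ⟩
  rotate^ j x                               ∎
  where open ≡-Reasoning

sumSubsets-rotate^ : ∀ n i (f : Subset n → ℤ) → sumSubsets n (f ∘ rotate^ i) ≡ sumSubsets n f
sumSubsets-rotate^ n       zero    f = refl
sumSubsets-rotate^ zero    (suc i) f = sumSubsets-rotate^ zero i f
sumSubsets-rotate^ (suc n) (suc i) f =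
  trans (sym (sumSubsets-∷ʳ n (f ∘ rotate^ i))) (sumSubsets-rotate^ (suc n) i f)

-- Least periods and canonical members of rotation orbits

-- The least j with i ≤ j < i + f satisfying P, or i + f if there is none.
leastFrom : {P : ℕ → Set} → Decidable P → ℕ → ℕ → ℕ
leastFrom P? i zero = i
leastFrom P? i (suc f) with P? i
... | yes _ = i
... | no  _ = leastFrom P? (suc i) f

module _ {P : ℕ → Set} (P? : Decidable P) where

  leastFrom-holds : ∀ i f → P (i ℕ.+ f) → P (leastFrom P? i f)
  leastFrom-holds i zero    p = subst P (ℕₚ.+-identityʳ i) p
  leastFrom-holds i (suc f) p with P? i
  ... | yes q = q
  ... | no  _ = leastFrom-holds (suc i) f (subst P (ℕₚ.+-suc i f) p)

  leastFrom-≥ : ∀ i f → i ≤ leastFrom P? i f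
  leastFrom-≥ i zero    = ℕₚ.≤-refl
  leastFrom-≥ i (suc f) with P? i
  ... | yes _ = ℕₚ.≤-refl
  ... | no  _ = ℕₚ.≤-trans (ℕₚ.n≤1+n i) (leastFrom-≥ (suc i) f)

  leastFrom-least : ∀ i f j → i ≤ j → j < leastFrom P? i f → ¬ P j
  leastFrom-least i zero    j i≤j j<i = ⊥-elim (ℕₚ.<⇒≱ j<i i≤j)
  leastFrom-least i (suc f) j i≤j j< with P? i
  ... | yes _ = ⊥-elim (ℕₚ.<⇒≱ j< i≤j)
  ... | no ¬p with ℕₚ.m≤n⇒m<n∨m≡n i≤j
  ...   | inj₂ refl = ¬p
  ...   | inj₁ i<j  = leastFrom-least (suc i) f j i<j j<

leastFrom-cong : ∀ {P Q : ℕ → Set} (P? : Decidable P) (Q? : Decidable Q) → (∀ j → P j ⇔ Q j) →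
                 ∀ i f → leastFrom P? i f ≡ leastFrom Q? i f
leastFrom-cong P? Q? P⇔Q i zero = refl
leastFrom-cong P? Q? P⇔Q i (suc f) with P? i | Q? i
... | yes _  | yes _  = refl
... | no  _  | no  _  = leastFrom-cong P? Q? P⇔Q (suc i) f
... | yes p  | no ¬q  = ⊥-elim (¬q (Equivalence.to (P⇔Q i) p))
... | no ¬p  | yes q  = ⊥-elim (¬p (Equivalence.from (P⇔Q i) q))

_≟ₛ_ : (x y : Subset n) → Dec (x ≡ y)
_≟ₛ_ = Vecₚ.≡-dec Bool._≟_

period : Subset (suc m) → ℕ
period {m} x = leastFrom (λ j → rotate^ j x ≟ₛ x) 1 m

module _ (x : Subset (suc m)) where

  rotate^-period : rotate^ (period x) x ≡ x
  rotate^-period = leastFrom-holds (λ j → rotate^ j x ≟ₛ x) 1 m (rotate^-length (suc m) x)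

  period-pos : 0 < period x
  period-pos = leastFrom-≥ (λ j → rotate^ j x ≟ₛ x) 1 m

  period-least : ∀ j → 0 < j → j < period x → rotate^ j x ≢ x
  period-least = leastFrom-least (λ j → rotate^ j x ≟ₛ x) 1 m

  instance
    _ = ℕ.>-nonZero period-pos

  period∣ : period x ∣ suc m
  period∣ = m%n≡0⇒n∣m (suc m) (period x) remainder≡0
    where
    rotate^-remainder : rotate^ (suc m % period x) x ≡ x
    rotate^-remainder =
      trans (rotate^-% (period x) x rotate^-period (suc m)) (rotate^-length (suc m) x)
    remainder≡0 : suc m % period x ≡ 0
    remainder≡0 with suc m % period x in eq
    ... | zero  = refl
    ... | suc r = ⊥-elim (period-least (suc r) (s≤s z≤n)
                    (subst (_< period x) eq (m%n<n (suc m) (period x)))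
                    (subst (λ t → rotate^ t x ≡ x) eq rotate^-remainder))

  -- The shift by (period x ∸ b) + a would be a period of x strictly between 0 and period x.
  rotate^-distinct-below-period : ∀ a b → a < b → b < period x → rotate^ a x ≢ rotate^ b x
  rotate^-distinct-below-period a b a<b b<d e = period-least (d ∸ b ℕ.+ a)
    (ℕₚ.<-≤-trans (ℕₚ.m<n⇒0<n∸m b<d) (ℕₚ.m≤m+n (d ∸ b) a))
    (ℕₚ.<-≤-trans (ℕₚ.+-monoʳ-< (d ∸ b) a<b) (ℕₚ.≤-reflexive (ℕₚ.m∸n+n≡m (ℕₚ.<⇒≤ b<d))))
    (begin
      rotate^ (d ∸ b ℕ.+ a) x          ≡⟨ rotate^-+ (d ∸ b) a x ⟩
      rotate^ (d ∸ b) (rotate^ a x)    ≡⟨ cong (rotate^ (d ∸ b)) e ⟩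
      rotate^ (d ∸ b) (rotate^ b x)    ≡⟨ sym (rotate^-+ (d ∸ b) b x) ⟩
      rotate^ (d ∸ b ℕ.+ b) x          ≡⟨ cong (λ t → rotate^ t x) (ℕₚ.m∸n+n≡m (ℕₚ.<⇒≤ b<d)) ⟩
      rotate^ d x                      ≡⟨ rotate^-period ⟩
      x                                ∎)
    where
    open ≡-Reasoning
    d = period x

  rotate^-injective-below-period : ∀ i r → i < period x → r < period x →
                                   rotate^ i x ≡ rotate^ r x → i ≡ r
  rotate^-injective-below-period i r i<d r<d e with ℕₚ.<-cmp i r
  ... | tri≈ _ i≡r _ = i≡r
  ... | tri< i<r _ _ = ⊥-elim (rotate^-distinct-below-period i r i<r r<d e)
  ... | tri> _ _ r<i = ⊥-elim (rotate^-distinct-below-period r i r<i i<d (sym e))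

period-rotate : (x : Subset (suc m)) → period (rotate x) ≡ period x
period-rotate {m} x = leastFrom-cong (λ j → rotate^ j (rotate x) ≟ₛ rotate x) (λ j → rotate^ j x ≟ₛ x)
  (λ j → mk⇔ (λ e → rotate-injective (trans (sym (rotate^-rotate j x)) e))
             (λ e → trans (rotate^-rotate j x) (cong rotate e)))
  1 m

period-rotate^ : ∀ i (x : Subset (suc m)) → period (rotate^ i x) ≡ period x
period-rotate^ zero    x = refl
period-rotate^ (suc i) x = trans (period-rotate^ i (rotate x)) (period-rotate x)

lexMin : Subset n → Subset n → Subset n
lexMin []          []          = []
lexMin (false ∷ x) (false ∷ y) = false ∷ lexMin x y
lexMin (false ∷ x) (true  ∷ y) = false ∷ x
lexMin (true  ∷ x) (false ∷ y) = false ∷ y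
lexMin (true  ∷ x) (true  ∷ y) = true ∷ lexMin x y

lexMin-comm : (x y : Subset n) → lexMin x y ≡ lexMin y x
lexMin-comm []          []          = refl
lexMin-comm (false ∷ x) (false ∷ y) = cong (false ∷_) (lexMin-comm x y)
lexMin-comm (false ∷ x) (true  ∷ y) = refl
lexMin-comm (true  ∷ x) (false ∷ y) = refl
lexMin-comm (true  ∷ x) (true  ∷ y) = cong (true ∷_) (lexMin-comm x y)

lexMin-assoc : (x y z : Subset n) → lexMin (lexMin x y) z ≡ lexMin x (lexMin y z)
lexMin-assoc []          []          []          = refl
lexMin-assoc (false ∷ x) (false ∷ y) (false ∷ z) = cong (false ∷_) (lexMin-assoc x y z)
lexMin-assoc (false ∷ x) (false ∷ y) (true  ∷ z) = refl
lexMin-assoc (false ∷ x) (true  ∷ y) (false ∷ z) = refl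
lexMin-assoc (false ∷ x) (true  ∷ y) (true  ∷ z) = refl
lexMin-assoc (true  ∷ x) (false ∷ y) (false ∷ z) = refl
lexMin-assoc (true  ∷ x) (false ∷ y) (true  ∷ z) = refl
lexMin-assoc (true  ∷ x) (true  ∷ y) (false ∷ z) = refl
lexMin-assoc (true  ∷ x) (true  ∷ y) (true  ∷ z) = cong (true ∷_) (lexMin-assoc x y z)

lexMin-sel : (x y : Subset n) → lexMin x y ≡ x ⊎ lexMin x y ≡ y
lexMin-sel []          []          = inj₁ refl
lexMin-sel (false ∷ x) (true  ∷ y) = inj₁ refl
lexMin-sel (true  ∷ x) (false ∷ y) = inj₂ refl
lexMin-sel (false ∷ x) (false ∷ y) = Sum.map (cong (false ∷_)) (cong (false ∷_)) (lexMin-sel x y)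
lexMin-sel (true  ∷ x) (true  ∷ y) = Sum.map (cong (true ∷_)) (cong (true ∷_)) (lexMin-sel x y)

minUpTo : (ℕ → Subset n) → ℕ → Subset n
minUpTo f zero    = f 0
minUpTo f (suc k) = lexMin (f (suc k)) (minUpTo f k)

minUpTo-suc : ∀ (f : ℕ → Subset n) k → minUpTo f (suc k) ≡ lexMin (f 0) (minUpTo (f ∘ suc) k)
minUpTo-suc f zero    = lexMin-comm (f 1) (f 0)
minUpTo-suc f (suc k) = begin
  lexMin a (minUpTo f (suc k)) ≡⟨ cong (lexMin a) (minUpTo-suc f k) ⟩
  lexMin a (lexMin (f 0) rest) ≡⟨ sym (lexMin-assoc a (f 0) rest) ⟩
  lexMin (lexMin a (f 0)) rest ≡⟨ cong (λ t → lexMin t rest) (lexMin-comm a (f 0)) ⟩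
  lexMin (lexMin (f 0) a) rest ≡⟨ lexMin-assoc (f 0) a rest ⟩
  lexMin (f 0) (lexMin a rest) ∎
  where
  open ≡-Reasoning
  a    = f (2 ℕ.+ k)
  rest = minUpTo (f ∘ suc) k

minUpTo-periodic : ∀ (f : ℕ → Subset n) k → f (suc k) ≡ f 0 → minUpTo (f ∘ suc) k ≡ minUpTo f k
minUpTo-periodic f zero    e = e
minUpTo-periodic f (suc k) e =
  trans (cong (λ t → lexMin t (minUpTo (f ∘ suc) k)) e) (sym (minUpTo-suc f k))

minUpTo-attained : ∀ (f : ℕ → Subset n) k → ∃[ j ] minUpTo f k ≡ f j
minUpTo-attained f zero = 0 , refl
minUpTo-attained f (suc k) with lexMin-sel (f (suc k)) (minUpTo f k)
... | inj₁ e = suc k , e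
... | inj₂ e with minUpTo-attained f k
...   | j , e′ = j , trans e e′

canonical : Subset (suc m) → Subset (suc m)
canonical {m} x = minUpTo (λ i → rotate^ i x) m

canonical-rotate : (x : Subset (suc m)) → canonical (rotate x) ≡ canonical x
canonical-rotate {m} x = minUpTo-periodic (λ i → rotate^ i x) m (rotate^-length (suc m) x)

canonical-rotate^ : ∀ i (x : Subset (suc m)) → canonical (rotate^ i x) ≡ canonical x
canonical-rotate^ zero    x = refl
canonical-rotate^ (suc i) x = trans (canonical-rotate^ i (rotate x)) (canonical-rotate x)

isCanonical : Subset (suc m) → ℤ
isCanonical x = if does (x ≟ₛ canonical x) then 1ℤ else 0ℤ

module _ (x : Subset (suc m)) where

  instance
    _ = ℕ.>-nonZero (period-pos x)

  sumBelow-period-isCanonical : sumBelow (period x) (λ i → isCanonical (rotate^ i x)) ≡ 1ℤ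
  sumBelow-period-isCanonical =
    trans (sumBelow-unique (period x) (λ i → isCanonical (rotate^ i x)) r<d others)
          (cong (if_then 1ℤ else 0ℤ) (dec-true (rotate^ r x ≟ₛ _) rotate^r-canonical))
    where
    j = proj₁ (minUpTo-attained (λ i → rotate^ i x) m)
    r = j % period x
    r<d : r < period x
    r<d = m%n<n j (period x)
    rotate^r≡canonical : rotate^ r x ≡ canonical x
    rotate^r≡canonical = trans (rotate^-% (period x) x (rotate^-period x) j)
                               (sym (proj₂ (minUpTo-attained (λ i → rotate^ i x) m)))
    rotate^r-canonical : rotate^ r x ≡ canonical (rotate^ r x)
    rotate^r-canonical = trans rotate^r≡canonical (sym (canonical-rotate^ r x))
    others : ∀ i → i < period x → i ≢ r → isCanonical (rotate^ i x) ≡ 0ℤ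
    others i i<d i≢r = cong (if_then 1ℤ else 0ℤ) (dec-false (rotate^ i x ≟ₛ _) λ e →
      i≢r (rotate^-injective-below-period x i r i<d r<d
            (trans e (trans (canonical-rotate^ i x) (sym rotate^r≡canonical)))))

-- Orbit counting modulo p

module _ (h : Subset (suc m) → ℤ) (h-rotate : ∀ x → h (rotate x) ≡ h x) where

  private
    N = suc m

    h-rotate^ : ∀ i x → h (rotate^ i x) ≡ h x
    h-rotate^ zero    x = refl
    h-rotate^ (suc i) x = trans (h-rotate^ i (rotate x)) (h-rotate x)

    period≤ : (x : Subset N) → period x ≤ N
    period≤ x = ∣⇒≤ (period∣ x)

    ifBelow : ℕ → ℕ → ℤ → ℤ
    ifBelow d i z = if does (i <? d) then z else 0ℤ

  -- Spread h x over the shifts of x (exactly one is canonical), then undo the shifts: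
  -- every canonical x collects one copy of h x per element of its orbit.
  sumSubsets-orbits : sumSubsets N h ≡ sumSubsets N (λ x → + period x * (h x * isCanonical x))
  sumSubsets-orbits = begin
    sumSubsets N h
      ≡⟨ sumSubsets-cong N spread ⟩
    sumSubsets N (λ x → sumBelow N (λ i → ifBelow (period x) i (h x * isCanonical (rotate^ i x))))
      ≡⟨ sumSubsets-sumBelow N N (λ x i → ifBelow (period x) i (h x * isCanonical (rotate^ i x))) ⟩
    sumBelow N (λ i → sumSubsets N (λ x → ifBelow (period x) i (h x * isCanonical (rotate^ i x))))
      ≡⟨ sumBelow-cong N (λ i _ → unshift i) ⟩
    sumBelow N (λ i → sumSubsets N (λ x → ifBelow (period x) i (h x * isCanonical x)))
      ≡⟨ sym (sumSubsets-sumBelow N N (λ x i → ifBelow (period x) i (h x * isCanonical x))) ⟩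
    sumSubsets N (λ x → sumBelow N (λ i → ifBelow (period x) i (h x * isCanonical x)))
      ≡⟨ sumSubsets-cong N collect ⟩
    sumSubsets N (λ x → + period x * (h x * isCanonical x)) ∎
    where
    open ≡-Reasoning

    spread : ∀ x → h x ≡ sumBelow N (λ i → ifBelow (period x) i (h x * isCanonical (rotate^ i x)))
    spread x = sym (begin
      sumBelow N (λ i → ifBelow (period x) i (h x * isCanonical (rotate^ i x)))
        ≡⟨ sumBelow-restrict N (period x) _ (period≤ x) ⟩
      sumBelow (period x) (λ i → h x * isCanonical (rotate^ i x))
        ≡⟨ sumBelow-* (period x) (h x) _ ⟩
      h x * sumBelow (period x) (λ i → isCanonical (rotate^ i x))
        ≡⟨ cong (h x *_) (sumBelow-period-isCanonical x) ⟩
      h x * 1ℤ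
        ≡⟨ ℤₚ.*-identityʳ (h x) ⟩
      h x ∎)

    unshift : ∀ i → sumSubsets N (λ x → ifBelow (period x) i (h x * isCanonical (rotate^ i x)))
                  ≡ sumSubsets N (λ x → ifBelow (period x) i (h x * isCanonical x))
    unshift i = trans
      (sumSubsets-cong N (λ x → cong₂ (λ d z → ifBelow d i (z * isCanonical (rotate^ i x)))
                                        (sym (period-rotate^ i x)) (sym (h-rotate^ i x))))
      (sumSubsets-rotate^ N i (λ y → ifBelow (period y) i (h y * isCanonical y)))

    collect : ∀ x → sumBelow N (λ i → ifBelow (period x) i (h x * isCanonical x))
                  ≡ + period x * (h x * isCanonical x)
    collect x = trans (sumBelow-restrict N (period x) _ (period≤ x)) (sumBelow-const (period x) _)

  p∣sumSubsets-invariant : ∀ {p} → (∀ d → d ∣ N → d ≢ 1 → p ∣ d) →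
    (∀ x → rotate x ≡ x → h x ≡ 0ℤ) → + p ∣ℤ sumSubsets N h
  p∣sumSubsets-invariant {p} p∣divisors h-fixed =
    subst (+ p ∣ℤ_) (sym sumSubsets-orbits) (sumSubsets-∣ N p∣term)
    where
    p∣term : ∀ x → + p ∣ℤ + period x * (h x * isCanonical x)
    p∣term x with period x ℕ.≟ 1
    ... | no d≢1 = ℤ∣.∣m⇒∣m*n {m = + period x} (h x * isCanonical x)
                     (ℤ∣.∣ᵤ⇒∣ (p∣divisors (period x) (period∣ x) d≢1))
    ... | yes d≡1 = ℤ∣.∣n⇒∣m*n (+ period x)
      (subst (λ t → + p ∣ℤ t * isCanonical x) (sym (h-fixed x fixed)) (ℤ∣.divides 0ℤ refl))
      where
      fixed : rotate x ≡ x
      fixed = subst (λ t → rotate^ t x ≡ x) d≡1 (rotate^-period x)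

-- The reduced Euler characteristic as a sum over subsets

sumℤ-++ : ∀ (xs ys : List ℤ) → sumℤ (xs ++ ys) ≡ sumℤ xs + sumℤ ys
sumℤ-++ []       ys = sym (ℤₚ.+-identityˡ _)
sumℤ-++ (x ∷ xs) ys = trans (cong (_+_ x) (sumℤ-++ xs ys)) (sym (ℤₚ.+-assoc x _ _))

sumℤ-map-filter : ∀ {X : Set} {P : X → Set} (P? : Decidable P) (f : X → ℤ) (xs : List X) →
  sumℤ (map f (filter P? xs)) ≡ sumℤ (map (λ x → if does (P? x) then f x else 0ℤ) xs)
sumℤ-map-filter P? f []       = refl
sumℤ-map-filter P? f (x ∷ xs) with does (P? x)
... | true  = cong (_+_ (f x)) (sumℤ-map-filter P? f xs)
... | false = trans (sumℤ-map-filter P? f xs) (sym (ℤₚ.+-identityˡ _))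

sumℤ-map-allSubsets : ∀ n (f : Subset n → ℤ) → sumℤ (map f (allSubsets n)) ≡ sumSubsets n f
sumℤ-map-allSubsets zero    f = ℤₚ.+-identityʳ (f [])
sumℤ-map-allSubsets (suc n) f = begin
  sumℤ (map f (map (false ∷_) xs ++ map (true ∷_) xs))
    ≡⟨ cong sumℤ (Listₚ.map-++ f (map (false ∷_) xs) (map (true ∷_) xs)) ⟩
  sumℤ (map f (map (false ∷_) xs) ++ map f (map (true ∷_) xs))
    ≡⟨ sumℤ-++ (map f (map (false ∷_) xs)) _ ⟩
  sumℤ (map f (map (false ∷_) xs)) + sumℤ (map f (map (true ∷_) xs))
    ≡⟨ cong₂ _+_ (cong sumℤ (sym (Listₚ.map-∘ xs))) (cong sumℤ (sym (Listₚ.map-∘ xs))) ⟩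
  sumℤ (map (f ∘ (false ∷_)) xs) + sumℤ (map (f ∘ (true ∷_)) xs)
    ≡⟨ cong₂ _+_ (sumℤ-map-allSubsets n _) (sumℤ-map-allSubsets n _) ⟩
  sumSubsets (suc n) f ∎
  where
  open ≡-Reasoning
  xs = allSubsets n

eulerTerm : ∀ n → List ℕ → Subset n → ℤ
eulerTerm n S x = if does (independent? n S x) then signPred ∣ x ∣ else 0ℤ

reducedEuler≡sumSubsets : ∀ n S → reducedEuler n S ≡ sumSubsets n (eulerTerm n S)
reducedEuler≡sumSubsets n S =
  trans (sumℤ-map-filter (independent? n S) (signPred ∘ ∣_∣) (allSubsets n))
        (sumℤ-map-allSubsets n (eulerTerm n S))

-- Rotation symmetry of the independence complex

data CyclicSucc (m a b : ℕ) : Set where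
  step : b ≡ suc a → CyclicSucc m a b
  wrap : a ≡ m → b ≡ 0 → CyclicSucc m a b

rotate-∈ : ∀ (v : Subset m) b i → i ∈ v ∷ʳ b → ∃[ j ] j ∈ b ∷ v × CyclicSucc m (toℕ i) (toℕ j)
rotate-∈ []      b Fin.zero here = Fin.zero , here , wrap refl refl
rotate-∈ (c ∷ v) b Fin.zero here = Fin.suc Fin.zero , there here , step refl
rotate-∈ (c ∷ v) b (Fin.suc i) (there i∈) with rotate-∈ v b i i∈
... | Fin.zero  , here     , wrap i≡m _ = Fin.zero , here , wrap (cong suc i≡m) refl
... | Fin.zero  , _        , step ()
... | Fin.suc j , there j∈ , step e     = Fin.suc (Fin.suc j) , there (there j∈) , step (cong suc e)
... | Fin.suc j , _        , wrap _ ()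

circDist-comm : ∀ n a b → circDist n a b ≡ circDist n b a
circDist-comm n a b = cong (λ d → d ⊓ (n ∸ d)) (ℕₚ.+-comm (a ∸ b) (b ∸ a))

circDist-wrap : ∀ m a → a ≤ m → circDist (suc m) (suc a) 0 ≡ circDist (suc m) a m
circDist-wrap m a a≤m = begin
  circDist (suc m) (suc a) 0 ≡⟨ cong (λ d → d ⊓ (suc m ∸ d)) (ℕₚ.+-identityʳ (suc a)) ⟩
  suc a ⊓ (m ∸ a)            ≡⟨ ℕₚ.⊓-comm (suc a) (m ∸ a) ⟩
  (m ∸ a) ⊓ suc a            ≡⟨ cong₂ _⊓_ (sym d≡m∸a) (sym (trans (cong (suc m ∸_) d≡m∸a) m+1∸[m∸a]≡a+1)) ⟩
  circDist (suc m) a m       ∎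
  where
  open ≡-Reasoning
  d≡m∸a : (a ∸ m) ℕ.+ (m ∸ a) ≡ m ∸ a
  d≡m∸a = cong (ℕ._+ (m ∸ a)) (ℕₚ.m≤n⇒m∸n≡0 a≤m)
  m+1∸[m∸a]≡a+1 : suc m ∸ (m ∸ a) ≡ suc a
  m+1∸[m∸a]≡a+1 = trans (ℕₚ.+-∸-assoc 1 (ℕₚ.m∸n≤m m a)) (cong suc (ℕₚ.m∸[m∸n]≡n a≤m))

circDist-cyclicSucc : ∀ {m a a′ b b′} → a ≤ m → a′ ≤ m → CyclicSucc m a b → CyclicSucc m a′ b′ →
                      circDist (suc m) b b′ ≡ circDist (suc m) a a′
circDist-cyclicSucc _ _ (step refl) (step refl) = refl
circDist-cyclicSucc {a = a} a≤m _ (step refl) (wrap refl refl) = circDist-wrap _ a a≤m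
circDist-cyclicSucc {m} {a′ = a′} _ a′≤m (wrap refl refl) (step refl) =
  trans (circDist-comm (suc m) 0 (suc a′)) (trans (circDist-wrap m a′ a′≤m) (circDist-comm (suc m) a′ m))
circDist-cyclicSucc {m} _ _ (wrap refl refl) (wrap refl refl) =
  cong (λ d → d ⊓ (suc m ∸ d)) (sym (cong₂ ℕ._+_ (ℕₚ.n∸n≡0 m) (ℕₚ.n∸n≡0 m)))

rotate-independent : ∀ {n} S (x : Subset n) → Independent n S x → Independent n S (rotate x)
rotate-independent S []      ind = ind
rotate-independent S (b ∷ v) ind i i′ i∈ i′∈ adj with rotate-∈ v b i i∈ | rotate-∈ v b i′ i′∈
... | j , j∈ , ij | j′ , j′∈ , i′j′ =
  ind j j′ j∈ j′∈ (subst (_∈ₗ S) (sym (circDist-cyclicSucc (toℕ≤ i) (toℕ≤ i′) ij i′j′)) adj)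
  where
  toℕ≤ : ∀ {m} (i : Fin (suc m)) → toℕ i ≤ m
  toℕ≤ i = ℕₚ.≤-pred (toℕ<n i)

rotate^-independent : ∀ {n} S i (x : Subset n) → Independent n S x → Independent n S (rotate^ i x)
rotate^-independent S zero    x ind = ind
rotate^-independent S (suc i) x ind = rotate^-independent S i (rotate x) (rotate-independent S x ind)

rotate-independent⁻¹ : ∀ {n} S (x : Subset n) → Independent n S (rotate x) → Independent n S x
rotate-independent⁻¹ {zero}  S [] ind = ind
rotate-independent⁻¹ {suc m} S x  ind =
  subst (Independent (suc m) S) (rotate^-length (suc m) x) (rotate^-independent S m (rotate x) ind)

∣v∷ʳb∣ : ∀ (v : Subset n) b → ∣ v ∷ʳ b ∣ ≡ ∣ b ∷ v ∣
∣v∷ʳb∣ []          b     = refl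
∣v∷ʳb∣ (true  ∷ v) true  = cong suc (∣v∷ʳb∣ v true)
∣v∷ʳb∣ (true  ∷ v) false = cong suc (∣v∷ʳb∣ v false)
∣v∷ʳb∣ (false ∷ v) b     = ∣v∷ʳb∣ v b

∣rotate∣ : (x : Subset n) → ∣ rotate x ∣ ≡ ∣ x ∣
∣rotate∣ []      = refl
∣rotate∣ (b ∷ v) = ∣v∷ʳb∣ v b

eulerTerm-rotate : ∀ n S (x : Subset n) → eulerTerm n S (rotate x) ≡ eulerTerm n S x
eulerTerm-rotate n S x = cong₂ (λ b c → if b then signPred c else 0ℤ)
  (does-⇔ (mk⇔ (rotate-independent⁻¹ S x) (rotate-independent S x))
          (independent? n S (rotate x)) (independent? n S x))
  (∣rotate∣ x)

-- Rotation-fixed subsets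

∷ʳ≡∷⇒replicate : ∀ (v : Vec A m) b → v ∷ʳ b ≡ b ∷ v → v ≡ replicate m b
∷ʳ≡∷⇒replicate []      b e = refl
∷ʳ≡∷⇒replicate (c ∷ v) b e with Vecₚ.∷-injective e
... | refl , e′ = cong (c ∷_) (∷ʳ≡∷⇒replicate v c e′)

rotate-replicate : ∀ n (b : A) → rotate (replicate n b) ≡ replicate n b
rotate-replicate zero    b = refl
rotate-replicate (suc n) b = replicate∷ʳ n
  where
  replicate∷ʳ : ∀ n → replicate n b ∷ʳ b ≡ b ∷ replicate n b
  replicate∷ʳ zero    = refl
  replicate∷ʳ (suc n) = cong (b ∷_) (replicate∷ʳ n)

rotate-fixed⇒⊥⊎⊤ : (x : Subset (suc m)) → rotate x ≡ x → x ≡ ⊥ ⊎ x ≡ ⊤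
rotate-fixed⇒⊥⊎⊤ (false ∷ v) e = inj₁ (cong (false ∷_) (∷ʳ≡∷⇒replicate v false e))
rotate-fixed⇒⊥⊎⊤ (true  ∷ v) e = inj₂ (cong (true ∷_) (∷ʳ≡∷⇒replicate v true e))

∣p∣≡0⇒p≡⊥ : (x : Subset n) → ∣ x ∣ ≡ 0 → x ≡ ⊥
∣p∣≡0⇒p≡⊥ []          _ = refl
∣p∣≡0⇒p≡⊥ (false ∷ x) e = cong (false ∷_) (∣p∣≡0⇒p≡⊥ x e)

eulerTerm-⊥ : ∀ n S → eulerTerm n S ⊥ ≡ -1ℤ
eulerTerm-⊥ n S = cong₂ (λ b c → if b then signPred c else 0ℤ)
  (dec-true (independent? n S ⊥) (λ i _ i∈⊥ _ _ → ∉⊥ i∈⊥)) (∣⊥∣≡0 n)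

s≤n/2⇒s+s≤n : ∀ {s n} → s ≤ n / 2 → s ℕ.+ s ≤ n
s≤n/2⇒s+s≤n {s} {n} s≤n/2 = begin
  s ℕ.+ s     ≡⟨ cong (s ℕ.+_) (sym (ℕₚ.+-identityʳ s)) ⟩
  2 ℕ.* s     ≡⟨ ℕₚ.*-comm 2 s ⟩
  s ℕ.* 2     ≤⟨ ℕₚ.*-monoˡ-≤ 2 s≤n/2 ⟩
  n / 2 ℕ.* 2 ≤⟨ m/n*n≤m n 2 ⟩
  n           ∎
  where open ℕₚ.≤-Reasoning

circDist-0 : ∀ n s → s ℕ.+ s ≤ n → circDist n 0 s ≡ s
circDist-0 n s s+s≤n =
  trans (cong (λ d → d ⊓ (n ∸ d)) (cong (ℕ._+ s) (ℕₚ.0∸n≡0 s)))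
        (ℕₚ.m≤n⇒m⊓n≡m (ℕₚ.m+n≤o⇒m≤o∸n s s+s≤n))

eulerTerm-⊤ : ∀ {n s S} → s ∈ₗ S → 1 ≤ s → s ≤ n / 2 → eulerTerm n S ⊤ ≡ 0ℤ
eulerTerm-⊤ {n} {s} {S} s∈S 1≤s s≤n/2 =
  cong (if_then signPred ∣ ⊤ {n} ∣ else 0ℤ) (dec-false (independent? n S ⊤) ⊤-dependent)
  where
  s<n : s < n
  s<n = ℕₚ.<-≤-trans (ℕₚ.m<m+n s 1≤s) (s≤n/2⇒s+s≤n s≤n/2)
  ⊤-dependent : ¬ Independent n S ⊤
  ⊤-dependent ind = ind (fromℕ< (ℕₚ.≤-<-trans z≤n s<n)) (fromℕ< s<n) ∈⊤ ∈⊤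
    (subst₂ (λ a b → circDist n a b ∈ₗ S) (sym (toℕ-fromℕ< _)) (sym (toℕ-fromℕ< s<n))
            (subst (_∈ₗ S) (sym (circDist-0 n s (s≤n/2⇒s+s≤n s≤n/2))) s∈S))

if-split : ∀ b (z : ℤ) → z ≡ (if b then z else 0ℤ) + (if b then 0ℤ else z)
if-split true  z = sym (ℤₚ.+-identityʳ z)
if-split false z = sym (ℤₚ.+-identityˡ z)

eulerTerm-fixed : ∀ {m s S} → s ∈ₗ S → 1 ≤ s → s ≤ suc m / 2 → (x : Subset (suc m)) →
  (if does (rotate x ≟ₛ x) then eulerTerm (suc m) S x else 0ℤ) ≡ (if does (∣ x ∣ ℕ.≟ 0) then -1ℤ else 0ℤ)
eulerTerm-fixed {m} {S = S} s∈S 1≤s s≤ x with rotate x ≟ₛ x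
... | no ¬fixed = sym (cong (if_then -1ℤ else 0ℤ) (dec-false (∣ x ∣ ℕ.≟ 0) λ ∣x∣≡0 →
  ¬fixed (subst (λ y → rotate y ≡ y) (sym (∣p∣≡0⇒p≡⊥ x ∣x∣≡0)) (rotate-replicate (suc m) false))))
... | yes fixed with rotate-fixed⇒⊥⊎⊤ x fixed
...   | inj₁ refl = trans (eulerTerm-⊥ (suc m) S)
  (sym (cong (if_then -1ℤ else 0ℤ) (dec-true (∣ ⊥ {suc m} ∣ ℕ.≟ 0) (∣⊥∣≡0 (suc m)))))
...   | inj₂ refl = trans (eulerTerm-⊤ {suc m} s∈S 1≤s s≤)
  (sym (cong (if_then -1ℤ else 0ℤ) (dec-false (∣ ⊤ {suc m} ∣ ℕ.≟ 0) λ ∣⊤∣≡0 →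
    ℕₚ.0≢1+n (trans (sym ∣⊤∣≡0) (∣⊤∣≡n (suc m))))))

p∣1+reducedEuler : ∀ {n p s S} → 0 < n → (∀ d → d ∣ n → d ≢ 1 → p ∣ d) →
                   s ∈ₗ S → 1 ≤ s → s ≤ n / 2 → + p ∣ℤ 1ℤ + reducedEuler n S
p∣1+reducedEuler {suc m} {p} {S = S} _ p∣divisors s∈S 1≤s s≤ =
  subst (+ p ∣ℤ_) (sym 1+χ≡Σoff) (p∣sumSubsets-invariant off off-rotate p∣divisors off-fixed)
  where
  N = suc m
  fixed? : Subset N → Bool
  fixed? x = does (rotate x ≟ₛ x)
  on off : Subset N → ℤ
  on  x = if fixed? x then eulerTerm N S x else 0ℤ
  off x = if fixed? x then 0ℤ else eulerTerm N S x

  off-rotate : ∀ x → off (rotate x) ≡ off x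
  off-rotate x = cong₂ (λ b z → if b then 0ℤ else z)
    (does-⇔ (mk⇔ rotate-injective (cong rotate)) (rotate (rotate x) ≟ₛ rotate x) (rotate x ≟ₛ x))
    (eulerTerm-rotate N S x)

  off-fixed : ∀ x → rotate x ≡ x → off x ≡ 0ℤ
  off-fixed x fixed = cong (if_then 0ℤ else eulerTerm N S x) (dec-true (rotate x ≟ₛ x) fixed)

  1+χ≡Σoff : 1ℤ + reducedEuler N S ≡ sumSubsets N off
  1+χ≡Σoff = begin
    1ℤ + reducedEuler N S
      ≡⟨ cong (_+_ 1ℤ) (reducedEuler≡sumSubsets N S) ⟩
    1ℤ + sumSubsets N (eulerTerm N S)
      ≡⟨ cong (_+_ 1ℤ) (sumSubsets-cong N (λ x → if-split (fixed? x) (eulerTerm N S x))) ⟩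
    1ℤ + sumSubsets N (λ x → on x + off x)
      ≡⟨ cong (_+_ 1ℤ) (sumSubsets-+ N on off) ⟩
    1ℤ + (sumSubsets N on + sumSubsets N off)
      ≡⟨ cong (λ t → 1ℤ + (t + sumSubsets N off))
              (trans (sumSubsets-cong N (eulerTerm-fixed s∈S 1≤s s≤)) (sumSubsets-empty N -1ℤ)) ⟩
    1ℤ + (-1ℤ + sumSubsets N off)
      ≡⟨ sym (ℤₚ.+-assoc 1ℤ -1ℤ (sumSubsets N off)) ⟩
    0ℤ + sumSubsets N off
      ≡⟨ ℤₚ.+-identityˡ (sumSubsets N off) ⟩
    sumSubsets N off ∎
    where open ≡-Reasoning

∣p^k∧≢1⇒p∣ : ∀ {p d} → Prime p → ∀ k → d ∣ p ^ k → d ≢ 1 → p ∣ d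
∣p^k∧≢1⇒p∣ prime[p] zero d∣1 d≢1 = ⊥-elim (d≢1 (∣1⇒≡1 d∣1))
∣p^k∧≢1⇒p∣ {p} {d} prime[p] (suc k) d∣p^[1+k] d≢1 with prime⇒irreducible prime[p] (gcd[m,n]∣n d p)
... | inj₂ gcd≡p = subst (_∣ d) gcd≡p (gcd[m,n]∣m d p)
... | inj₁ gcd≡1 = ∣p^k∧≢1⇒p∣ prime[p] k (coprime-divisor (gcd≡1⇒coprime gcd≡1) d∣p^[1+k]) d≢1

theorem2p3 : (p k : ℕ) → Prime p → 0 < k → (S : List ℕ)
    → S ≢ [] → All (λ s → 1 ≤ s × s ≤ (p ^ k) / 2) S
    → reducedEuler (p ^ k) S ≢ 0ℤ
theorem2p3 p k prime[p] _ []      S≢[] _                    = ⊥-elim (S≢[] refl)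
theorem2p3 p k prime[p] _ (s ∷ S) _    ((1≤s , s≤) ∷ _) χ≡0 =
  ¬prime[1] (subst Prime (∣1⇒≡1 (ℤ∣.∣⇒∣ᵤ p∣1)) prime[p])
  where
  p∣1 : + p ∣ℤ 1ℤ
  p∣1 = subst (λ χ → + p ∣ℤ 1ℤ + χ) χ≡0
    (p∣1+reducedEuler (ℕₚ.m^n>0 p {{prime⇒nonZero prime[p]}} k) (λ d → ∣p^k∧≢1⇒p∣ prime[p] k)
                      (here refl) 1≤s s≤)
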